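{- Every non-evasive simplicial $d$-complex with $d\ge 1$ has at least two free faces.
   Context: A face $\sigma$ of a simplicial complex $C$ is free if it is properly contained in exactly one other face of $C$. Non-evasiveness is defined recursively: a single vertex is non-evasive, and a simplicial complex $C$ with more than one vertex is non-evasive if there is a vertex $v$ of $C$ such that both the link $\mathrm{lk}_C(v)$ and the deletion $C - v$ (the subcomplex of faces not containing $v$) are non-evasive. -}

module Defs where

open import Data.Nat using (ℕ; suc; _≤_)
open import Data.Fin using (Fin)
open import Data.Fin.Subset using (Subset; _⊆_; _⊂_; _∈_; _∉_; _∪_; ⁅_⁆; ∣_∣)
  renaming (⊥ to ∅)
open import Data.Product using (Σ; ∃; ∃-syntax; _×_)
open import Relation.Binary.PropositionalEquality using (_≡_; _≢_)

Family : ℕ → Set₁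
Family n = Subset n → Set

record IsSimplicialComplex {n : ℕ} (F : Family n) : Set where
  field
    empty-face : F ∅
    down-closed : ∀ σ τ → τ ⊆ σ → F σ → F τ

IsVertex : ∀ {n} → Family n → Fin n → Set
IsVertex F v = F ⁅ v ⁆

lk : ∀ {n} → Family n → Fin n → Family n
lk F v σ = v ∉ σ × F (σ ∪ ⁅ v ⁆)

del : ∀ {n} → Family n → Fin n → Family n
del F v σ = v ∉ σ × F σ

data NonEvasive {n : ℕ} (F : Family n) : Set where
  single-vertex : (v : Fin n) → IsVertex F v →
                  (∀ w → IsVertex F w → w ≡ v) → NonEvasive F
  split : (∃[ u ] ∃[ w ] (u ≢ w × IsVertex F u × IsVertex F w)) →
          (v : Fin n) → IsVertex F v →
          NonEvasive (lk F v) → NonEvasive (del F v) → NonEvasive F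

HasDimension : ∀ {n} → Family n → ℕ → Set
HasDimension F d = (∃[ σ ] (F σ × ∣ σ ∣ ≡ suc d)) × (∀ σ → F σ → ∣ σ ∣ ≤ suc d)

IsFree : ∀ {n} → Family n → Subset n → Set
IsFree F σ = F σ × ∃[ τ ] (F τ × σ ⊂ τ × (∀ τ' → F τ' → σ ⊂ τ' → τ' ≡ τ))

-- Induct on non-evasiveness, proving that a non-evasive complex is either a
-- single vertex or has two free faces.  Coning with v turns a free face σ of
-- lk v into the free face σ ∪ {v}, so two free faces of the link lift.  If
-- instead lk v is a single vertex w, then {v} is free (lifted from the free
-- face ∅ of the link), and the deletion supplies a second free face avoiding
-- v: {w} if the deletion is a single vertex, otherwise any of its free faces
-- not contained in {w}, which no face through v can contain.  Finally a
-- single vertex has dimension 0.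
module Submission where

open import Defs
open import Data.Nat using (ℕ; _≤_; _<_; s≤s)
open import Data.Nat.Properties using (<⇒≱)
open import Data.Fin using (Fin)
open import Data.Fin.Properties using (_≟_)
open import Data.Fin.Subset
  using (Subset; _⊆_; _⊂_; _∈_; _∉_; _∪_; _─_; _-_; ⁅_⁆; ∣_∣; inside; outside)
  renaming (⊥ to ∅)
open import Data.Fin.Subset.Properties
open import Data.Vec.Base using (_∷_; there)
open import Data.Product using (∃-syntax; _×_; _,_; proj₁)
open import Data.Sum using (_⊎_; inj₁; inj₂)
open import Data.Empty using (⊥-elim)
open import Function using (_∘_)
open import Relation.Nullary using (¬_; yes; no; contradiction)
open import Relation.Binary.PropositionalEquality
  using (_≡_; _≢_; refl; sym; trans; cong; subst; module ≡-Reasoning)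
open ≡-Reasoning

open IsSimplicialComplex

private
  variable
    n : ℕ
    p q r : Subset n
    x y v w : Fin n
    σ τ : Subset n
    F : Family n

x∈p─q⇒x∉q : ∀ (p q : Subset n) → x ∈ p ─ q → x ∉ q
x∈p─q⇒x∉q (_ ∷ p) (inside  ∷ q) (there x∈) (there x∈q) = x∈p─q⇒x∉q p q x∈ x∈q
x∈p─q⇒x∉q (_ ∷ p) (outside ∷ q) (there x∈) (there x∈q) = x∈p─q⇒x∉q p q x∈ x∈q

x∉p-x : ∀ (p : Subset n) → x ∉ p - x
x∉p-x {x = x} p x∈ = x∈p─q⇒x∉q p ⁅ x ⁆ x∈ (x∈⁅x⁆ x)

x∈p⇒⁅x⁆⊆p : x ∈ p → ⁅ x ⁆ ⊆ p
x∈p⇒⁅x⁆⊆p {x = x} x∈p y∈ = subst (_∈ _) (sym (x∈⁅y⁆⇒x≡y x y∈)) x∈p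

x∈p∪⁅x⁆ : ∀ (p : Subset n) → x ∈ p ∪ ⁅ x ⁆
x∈p∪⁅x⁆ {x = x} p = x∈p∪q⁺ (inj₂ (x∈⁅x⁆ x))

∪-monoˡ-⊆ : p ⊆ q → p ∪ r ⊆ q ∪ r
∪-monoˡ-⊆ {p = p} {r = r} p⊆q y∈ with x∈p∪q⁻ p r y∈
... | inj₁ y∈p = x∈p∪q⁺ (inj₁ (p⊆q y∈p))
... | inj₂ y∈r = x∈p∪q⁺ (inj₂ y∈r)

∪⁅x⁆⊆ : p ⊆ q → x ∈ q → p ∪ ⁅ x ⁆ ⊆ q
∪⁅x⁆⊆ {p = p} {x = x} p⊆q x∈q y∈ with x∈p∪q⁻ p ⁅ x ⁆ y∈
... | inj₁ y∈p = p⊆q y∈p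
... | inj₂ y∈⁅x⁆ = x∈p⇒⁅x⁆⊆p x∈q y∈⁅x⁆

p-x∪⁅x⁆≡p : x ∈ p → (p - x) ∪ ⁅ x ⁆ ≡ p
p-x∪⁅x⁆≡p {x = x} {p = p} x∈p = ⊆-antisym (∪⁅x⁆⊆ (p─q⊆p p ⁅ x ⁆) x∈p) p⊆
  where
  p⊆ : p ⊆ (p - x) ∪ ⁅ x ⁆
  p⊆ {y} y∈p with y ≟ x
  ... | yes refl = x∈p∪⁅x⁆ (p - x)
  ... | no y≢x = x∈p∪q⁺ (inj₁ (x∈p∧x≢y⇒x∈p-y y∈p y≢x))

p∪⁅x⁆-x≡p : x ∉ p → (p ∪ ⁅ x ⁆) - x ≡ p
p∪⁅x⁆-x≡p {x = x} {p = p} x∉p = ⊆-antisym ⊆p p⊆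
  where
  ⊆p : (p ∪ ⁅ x ⁆) - x ⊆ p
  ⊆p y∈ with x∈p∪q⁻ p ⁅ x ⁆ (p─q⊆p (p ∪ ⁅ x ⁆) ⁅ x ⁆ y∈)
  ... | inj₁ y∈p = y∈p
  ... | inj₂ y∈⁅x⁆ = contradiction y∈⁅x⁆ (x∈p─q⇒x∉q (p ∪ ⁅ x ⁆) ⁅ x ⁆ y∈)
  p⊆ : p ⊆ (p ∪ ⁅ x ⁆) - x
  p⊆ y∈p = x∈p∧x≢y⇒x∈p-y (x∈p∪q⁺ (inj₁ y∈p)) λ { refl → x∉p y∈p }

∪⁅x⁆-injective : x ∉ p → x ∉ q → p ∪ ⁅ x ⁆ ≡ q ∪ ⁅ x ⁆ → p ≡ q
∪⁅x⁆-injective {x = x} x∉p x∉q eq =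
  trans (sym (p∪⁅x⁆-x≡p x∉p)) (trans (cong (_- x) eq) (p∪⁅x⁆-x≡p x∉q))

∪⁅x⁆-mono-⊂ : x ∉ q → p ⊂ q → p ∪ ⁅ x ⁆ ⊂ q ∪ ⁅ x ⁆
∪⁅x⁆-mono-⊂ {x = x} {q = q} {p = p} x∉q (p⊆q , y , y∈q , y∉p) =
  ∪-monoˡ-⊆ p⊆q , y , x∈p∪q⁺ (inj₁ y∈q) , y∉
  where
  y∉ : y ∉ p ∪ ⁅ x ⁆
  y∉ y∈ with x∈p∪q⁻ p ⁅ x ⁆ y∈
  ... | inj₁ y∈p = y∉p y∈p
  ... | inj₂ y∈⁅x⁆ = x∉q (subst (_∈ q) (x∈⁅y⁆⇒x≡y x y∈⁅x⁆) y∈q)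

p⊆q∧x∉p⇒p⊆q-x : p ⊆ q → x ∉ p → p ⊆ q - x
p⊆q∧x∉p⇒p⊆q-x p⊆q x∉p y∈p = x∈p∧x≢y⇒x∈p-y (p⊆q y∈p) λ { refl → x∉p y∈p }

∪⁅x⁆⊂⇒⊂-x : x ∉ p → p ∪ ⁅ x ⁆ ⊂ q → p ⊂ q - x
∪⁅x⁆⊂⇒⊂-x {x = x} {p = p} x∉p (p∪x⊆q , y , y∈q , y∉) =
  p⊆q∧x∉p⇒p⊆q-x (p∪x⊆q ∘ x∈p∪q⁺ ∘ inj₁) x∉p ,
  y , x∈p∧x≢y⇒x∈p-y y∈q (λ { refl → y∉ (x∈p∪⁅x⁆ p) }) , y∉ ∘ x∈p∪q⁺ ∘ inj₁

⊆⁅x⁆⇒≡∅⊎≡⁅x⁆ : p ⊆ ⁅ x ⁆ → p ≡ ∅ ⊎ p ≡ ⁅ x ⁆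
⊆⁅x⁆⇒≡∅⊎≡⁅x⁆ {p = p} {x = x} p⊆ with x ∈? p
... | yes x∈p = inj₂ (⊆-antisym p⊆ (x∈p⇒⁅x⁆⊆p x∈p))
... | no x∉p = inj₁ (⊆-antisym ⊆∅ ⊥⊆)
  where
  ⊆∅ : p ⊆ ∅
  ⊆∅ y∈p = contradiction (subst (_∈ p) (x∈⁅y⁆⇒x≡y x (p⊆ y∈p)) y∈p) x∉p

∅⊂⁅x⁆ : ∅ ⊂ ⁅ x ⁆
∅⊂⁅x⁆ {x = x} = ⊥⊆ , x , x∈⁅x⁆ x , ∉⊥

⊆⁅x⁆-distinct⇒⊂ : p ⊆ ⁅ x ⁆ → q ⊆ ⁅ x ⁆ → p ≢ q → p ⊂ q ⊎ q ⊂ p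
⊆⁅x⁆-distinct⇒⊂ p⊆ q⊆ p≢q with ⊆⁅x⁆⇒≡∅⊎≡⁅x⁆ p⊆ | ⊆⁅x⁆⇒≡∅⊎≡⁅x⁆ q⊆
... | inj₁ refl | inj₁ refl = contradiction refl p≢q
... | inj₂ refl | inj₂ refl = contradiction refl p≢q
... | inj₁ refl | inj₂ refl = inj₁ ∅⊂⁅x⁆
... | inj₂ refl | inj₁ refl = inj₂ ∅⊂⁅x⁆

⁅x⁆⊂p⇒p⊈⁅y⁆ : ⁅ x ⁆ ⊂ p → ¬ p ⊆ ⁅ y ⁆
⁅x⁆⊂p⇒p⊈⁅y⁆ {x = x} {p = p} {y = y} x⊂p p⊆y =
  <⇒≱ (subst (λ k → k < ∣ p ∣) (∣⁅x⁆∣≡1 x) (p⊂q⇒∣p∣<∣q∣ x⊂p))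
      (subst (∣ p ∣ ≤_) (∣⁅x⁆∣≡1 y) (p⊆q⇒∣p∣≤∣q∣ p⊆y))

IsPoint : Family n → Set
IsPoint F = ∃[ v ] (F ⁅ v ⁆ × (∀ σ → F σ → σ ⊆ ⁅ v ⁆))

HasTwoFreeFaces : Family n → Set
HasTwoFreeFaces F = ∃[ σ ] ∃[ τ ] (σ ≢ τ × IsFree F σ × IsFree F τ)

lk-isSimplicialComplex : IsSimplicialComplex F → F ⁅ v ⁆ →
                         IsSimplicialComplex (lk F v)
lk-isSimplicialComplex {v = v} C Fv .empty-face =
  ∉⊥ , down-closed C ⁅ v ⁆ (∅ ∪ ⁅ v ⁆) (∪⁅x⁆⊆ ⊥⊆ (x∈⁅x⁆ v)) Fv
lk-isSimplicialComplex C Fv .down-closed σ τ τ⊆σ (v∉σ , Fσv) =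
  v∉σ ∘ τ⊆σ , down-closed C _ _ (∪-monoˡ-⊆ τ⊆σ) Fσv

del-isSimplicialComplex : IsSimplicialComplex F → IsSimplicialComplex (del F v)
del-isSimplicialComplex C .empty-face = ∉⊥ , empty-face C
del-isSimplicialComplex C .down-closed σ τ τ⊆σ (v∉σ , Fσ) =
  v∉σ ∘ τ⊆σ , down-closed C σ τ τ⊆σ Fσ

lk-remove : F σ → v ∈ σ → lk F v (σ - v)
lk-remove {F = F} Fσ v∈σ = x∉p-x _ , subst F (sym (p-x∪⁅x⁆≡p v∈σ)) Fσ

IsFree-lk⇒IsFree-∪⁅v⁆ : IsFree (lk F v) σ → IsFree F (σ ∪ ⁅ v ⁆)
IsFree-lk⇒IsFree-∪⁅v⁆ {F = F} {v = v} {σ = σ}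
  ((v∉σ , Fσv) , τ , (v∉τ , Fτv) , σ⊂τ , unique) =
  Fσv , τ ∪ ⁅ v ⁆ , Fτv , ∪⁅x⁆-mono-⊂ v∉τ σ⊂τ , unique′
  where
  unique′ : ∀ τ′ → F τ′ → σ ∪ ⁅ v ⁆ ⊂ τ′ → τ′ ≡ τ ∪ ⁅ v ⁆
  unique′ τ′ Fτ′ σv⊂τ′ = begin
    τ′                ≡⟨ sym (p-x∪⁅x⁆≡p v∈τ′) ⟩
    (τ′ - v) ∪ ⁅ v ⁆  ≡⟨ cong (_∪ ⁅ v ⁆) τ′-v≡τ ⟩
    τ ∪ ⁅ v ⁆         ∎
    where
    v∈τ′ : v ∈ τ′
    v∈τ′ = proj₁ σv⊂τ′ (x∈p∪⁅x⁆ σ)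
    τ′-v≡τ : τ′ - v ≡ τ
    τ′-v≡τ = unique (τ′ - v) (lk-remove {F = F} Fτ′ v∈τ′) (∪⁅x⁆⊂⇒⊂-x v∉σ σv⊂τ′)

IsFree-del⇒IsFree : IsFree (del F v) σ → (∀ ρ → lk F v ρ → ¬ σ ⊆ ρ) → IsFree F σ
IsFree-del⇒IsFree {F = F} {v = v} {σ = σ}
  ((v∉σ , Fσ) , τ , (_ , Fτ) , σ⊂τ , unique) σ⊈lk =
  Fσ , τ , Fτ , σ⊂τ , unique′
  where
  unique′ : ∀ τ′ → F τ′ → σ ⊂ τ′ → τ′ ≡ τ
  unique′ τ′ Fτ′ σ⊂τ′ with v ∈? τ′
  ... | no v∉τ′ = unique τ′ (v∉τ′ , Fτ′) σ⊂τ′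
  ... | yes v∈τ′ = ⊥-elim (σ⊈lk (τ′ - v) (lk-remove {F = F} Fτ′ v∈τ′)
                                (p⊆q∧x∉p⇒p⊆q-x (proj₁ σ⊂τ′) v∉σ))

IsPoint⇒IsFree-∅ : IsSimplicialComplex F → IsPoint F → IsFree F ∅
IsPoint⇒IsFree-∅ {F = F} C (v , Fv , ⊆⁅v⁆) = empty-face C , ⁅ v ⁆ , Fv , ∅⊂⁅x⁆ , unique
  where
  unique : ∀ τ → F τ → ∅ ⊂ τ → τ ≡ ⁅ v ⁆
  unique τ Fτ ∅⊂τ with ⊆⁅x⁆⇒≡∅⊎≡⁅x⁆ (⊆⁅v⁆ τ Fτ)
  ... | inj₁ refl = contradiction ∅⊂τ (⊂-irref refl)
  ... | inj₂ τ≡⁅v⁆ = τ≡⁅v⁆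

IsPoint⇒∣face∣≤1 : IsPoint F → F σ → ∣ σ ∣ ≤ 1
IsPoint⇒∣face∣≤1 {σ = σ} (v , _ , ⊆⁅v⁆) Fσ =
  subst (∣ σ ∣ ≤_) (∣⁅x⁆∣≡1 v) (p⊆q⇒∣p∣≤∣q∣ (⊆⁅v⁆ σ Fσ))

free⊂free⇒⊥ : IsFree F σ → IsFree F τ → ¬ σ ⊂ τ
free⊂free⇒⊥ (_ , _ , _ , _ , unique) (Fτ , ρ , Fρ , τ⊂ρ , _) σ⊂τ =
  ⊂-irref (trans (unique _ Fτ σ⊂τ) (sym (unique ρ Fρ (⊂-trans σ⊂τ τ⊂ρ)))) τ⊂ρ

HasTwoFreeFaces⇒free-⊈⁅x⁆ : HasTwoFreeFaces F → ∃[ σ ] (IsFree F σ × ¬ σ ⊆ ⁅ x ⁆)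
HasTwoFreeFaces⇒free-⊈⁅x⁆ {x = x} (σ , τ , σ≢τ , free-σ , free-τ)
  with σ ⊆? ⁅ x ⁆ | τ ⊆? ⁅ x ⁆
... | no σ⊈ | _       = σ , free-σ , σ⊈
... | yes _ | no τ⊈   = τ , free-τ , τ⊈
... | yes σ⊆ | yes τ⊆ with ⊆⁅x⁆-distinct⇒⊂ σ⊆ τ⊆ σ≢τ
...   | inj₁ σ⊂τ = ⊥-elim (free⊂free⇒⊥ free-σ free-τ σ⊂τ)
...   | inj₂ τ⊂σ = ⊥-elim (free⊂free⇒⊥ free-τ free-σ τ⊂σ)

HasTwoFreeFaces-lk⇒HasTwoFreeFaces : HasTwoFreeFaces (lk F v) → HasTwoFreeFaces F
HasTwoFreeFaces-lk⇒HasTwoFreeFaces (σ , τ , σ≢τ , free-σ , free-τ) =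
  σ ∪ ⁅ _ ⁆ , τ ∪ ⁅ _ ⁆ ,
  σ≢τ ∘ ∪⁅x⁆-injective (proj₁ (proj₁ free-σ)) (proj₁ (proj₁ free-τ)) ,
  IsFree-lk⇒IsFree-∪⁅v⁆ free-σ , IsFree-lk⇒IsFree-∪⁅v⁆ free-τ

lk-point∧del-point⇒IsFree-⁅w⁆ : IsSimplicialComplex F → lk F v ⁅ w ⁆ →
  (∀ ρ → lk F v ρ → ρ ⊆ ⁅ w ⁆) → IsPoint (del F v) → IsFree F ⁅ w ⁆
lk-point∧del-point⇒IsFree-⁅w⁆ {F = F} {v = v} {w = w}
  C (v∉⁅w⁆ , F⁅w⁆∪⁅v⁆) lk⊆⁅w⁆ (_ , _ , del⊆⁅u⁆) =
  down-closed C _ ⁅ w ⁆ (p⊆p∪q ⁅ v ⁆) F⁅w⁆∪⁅v⁆ ,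
  ⁅ w ⁆ ∪ ⁅ v ⁆ , F⁅w⁆∪⁅v⁆ , (p⊆p∪q ⁅ v ⁆ , v , x∈p∪⁅x⁆ ⁅ w ⁆ , v∉⁅w⁆) , unique
  where
  unique : ∀ τ → F τ → ⁅ w ⁆ ⊂ τ → τ ≡ ⁅ w ⁆ ∪ ⁅ v ⁆
  unique τ Fτ w⊂τ with v ∈? τ
  ... | no v∉τ = ⊥-elim (⁅x⁆⊂p⇒p⊈⁅y⁆ w⊂τ (del⊆⁅u⁆ τ (v∉τ , Fτ)))
  ... | yes v∈τ = ⊆-antisym τ⊆ (∪⁅x⁆⊆ (proj₁ w⊂τ) v∈τ)
    where
    τ⊆ : τ ⊆ ⁅ w ⁆ ∪ ⁅ v ⁆
    τ⊆ = subst (_⊆ _) (p-x∪⁅x⁆≡p v∈τ)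
               (∪-monoˡ-⊆ (lk⊆⁅w⁆ (τ - v) (lk-remove {F = F} Fτ v∈τ)))

lk-point⇒free-face-∌v : IsSimplicialComplex F → IsPoint (lk F v) →
  IsPoint (del F v) ⊎ HasTwoFreeFaces (del F v) → ∃[ τ ] (v ∉ τ × IsFree F τ)
lk-point⇒free-face-∌v C (w , lk⁅w⁆ , lk⊆⁅w⁆) (inj₁ del-point) =
  ⁅ w ⁆ , proj₁ lk⁅w⁆ , lk-point∧del-point⇒IsFree-⁅w⁆ C lk⁅w⁆ lk⊆⁅w⁆ del-point
lk-point⇒free-face-∌v C (w , _ , lk⊆⁅w⁆) (inj₂ del-two)
  with HasTwoFreeFaces⇒free-⊈⁅x⁆ del-two
... | σ , free-σ , σ⊈⁅w⁆ =
  σ , proj₁ (proj₁ free-σ) ,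
  IsFree-del⇒IsFree free-σ λ ρ lkρ σ⊆ρ → σ⊈⁅w⁆ (⊆-trans σ⊆ρ (lk⊆⁅w⁆ ρ lkρ))

nonEvasive⇒IsPoint⊎HasTwoFreeFaces : IsSimplicialComplex F → NonEvasive F →
                                     IsPoint F ⊎ HasTwoFreeFaces F
nonEvasive⇒IsPoint⊎HasTwoFreeFaces {F = F} C (single-vertex v Fv only-v) =
  inj₁ (v , Fv , λ σ Fσ x∈σ →
    subst (_∈ ⁅ v ⁆) (sym (only-v _ (vertex Fσ x∈σ))) (x∈⁅x⁆ v))
  where
  vertex : F σ → x ∈ σ → IsVertex F x
  vertex {σ} Fσ x∈σ = down-closed C σ _ (x∈p⇒⁅x⁆⊆p x∈σ) Fσ
nonEvasive⇒IsPoint⊎HasTwoFreeFaces C (split _ v Fv ne-lk ne-del)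
  with nonEvasive⇒IsPoint⊎HasTwoFreeFaces (lk-isSimplicialComplex C Fv) ne-lk
... | inj₂ lk-two = inj₂ (HasTwoFreeFaces-lk⇒HasTwoFreeFaces lk-two)
... | inj₁ lk-point
  with lk-point⇒free-face-∌v C lk-point
         (nonEvasive⇒IsPoint⊎HasTwoFreeFaces (del-isSimplicialComplex C) ne-del)
...   | τ , v∉τ , free-τ =
  inj₂ (∅ ∪ ⁅ v ⁆ , τ , (λ eq → v∉τ (subst (v ∈_) eq (x∈p∪⁅x⁆ ∅))) ,
        IsFree-lk⇒IsFree-∪⁅v⁆ (IsPoint⇒IsFree-∅ (lk-isSimplicialComplex C Fv) lk-point) ,
        free-τ)

lemma2p4 : (n d : ℕ) (C : Family n) → IsSimplicialComplex C → HasDimension C d →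
    1 ≤ d → NonEvasive C →
    ∃[ σ ] ∃[ τ ] (σ ≢ τ × IsFree C σ × IsFree C τ)
lemma2p4 n d C isC ((σ , Cσ , ∣σ∣≡1+d) , _) 1≤d ne
  with nonEvasive⇒IsPoint⊎HasTwoFreeFaces isC ne
... | inj₂ two = two
... | inj₁ point =
  contradiction (subst (_≤ 1) ∣σ∣≡1+d (IsPoint⇒∣face∣≤1 point Cσ)) (<⇒≱ (s≤s 1≤d))
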